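{- In the setting of the context, let $\omega=y_2^{a_2}y_1^{a_1}x_P^v\,dx\in H_P$ and $\omega'=y_2^{b_2}y_1^{b_1}x_Q^w\,dx\in H_Q$. If $\kappa(\mathcal{C}(\omega))=\kappa(\mathcal{C}(\omega'))$, then $P=Q$. Moreover, if $P=Q\in B_1$, then $\omega,\omega'$ have the same key term if and only if $$v+d_P(a_1+pa_2)=w+d_P(b_1+pb_2)\quad\text{and}\quad v-d_P\alpha_P(v)=w-d_P\alpha_P(w);$$ and if $P=Q\in B_2\setminus B_1$, then $\omega,\omega'$ have the same key term if and only if $$v+e_Pa_2=w+e_Pb_2,\quad a_1=b_1,\quad\text{and}\quad v-e_P\alpha_P(v)=w-e_P\alpha_P(w).$$
   Context: Let $p>2$ be prime, $k$ algebraically closed of characteristic $p$, $x$ a coordinate on $\mathbb{P}^1_k$. Let $f,h\in k(x)$ and $g(T)=\sum_{i=1}^{p-1}(-1)^i\frac{(p-1)!}{i!(p-i)!}T^{p(p-i)+i}$. Let $Y_1: y_1^p-y_1=f(x)$, $Y_2: y_2^p-y_2=g(y_1)+h(x)$, the $\mathbb{Z}/p^2\mathbb{Z}$-cover attached to the reduced Witt vector $(f,h)$, assumed minimal. Standing normalizations: $B_1$ = poles of $f$, $\infty\in B_1$; $x_\infty=x$, $x_P=(x-P)^{ -1}$ ($P\ne\infty$); $f=\sum_{P\in B_1}f_P(x_P)$ with $f_P\in k[x_P]$ of degree $d_P\mid p-1$ and leading coefficient $u_P\in k^\times$, $u_\infty=1$; $\operatorname{ord}_P(h)>-pd_P$ for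 $P\in B_1$. $B_2\supseteq B_1$ is the branch locus of $Y_2\to\mathbb{P}^1$; for $P\in B_2\setminus B_1$, $f$ is regular at $P$ and $h$ has a pole of order $e_P\mid p-1$ at $P$. $\gamma_P=(p-1)/d_P$, $\delta_P=(p-1)/e_P$, $\epsilon_\infty=-1$, $\epsilon_P=1$ for $P\ne\infty$. $W_\infty=\{y_2^{a_2}y_1^{a_1}x^vdx:0\le a_1,a_2<p,\ 0\le p^2v\le pd_\infty(p-1-a_1)+d_\infty(p^2-p+1)(p-1-a_2)-p^2-1\}$; for $P\in B_1\setminus\{\infty\}$, $W_P=\{y_2^{a_2}y_1^{a_1}x_P^vdx:0\le a_i<p,\ 0<p^2v\le pd_P(p-1-a_1)+d_P(p^2-p+1)(p-1-a_2)+p^2-1\}$; for $P\in B_2\setminus B_1$, $W_P=\{y_2^{a_2}y_1^{a_1}x_P^vdx:0\le a_i<p,\ 0<pv\le e_P(p-1-a_2)+p-1\}$. Key terms: for $P\in B_1$, $\alpha_P(v)=\lfloor\gamma_P(v-\epsilon_P)/p\rfloor$, $\beta_P(v)=\gamma_P(v-\epsilon_P)-p\alpha_P(v)$, $H_P=\{y_2^{a_2}y_1^{a_1}x_P^vdx\in W_P:\beta_P(v)\le a_1+pa_2\}$, $\kappa(\mathcal{C}(\omega))=y_2^{a_2}y_1^{a_1-\beta_P(v)}x_P^{v-d_P\alpha_P(v)}dx$ if $a_1\ge\beta_P(v)$ and $y_2^{a_2-1}y_1^{a_1-\beta_P(v)+p}x_P^{v-d_P\alpha_P(v)}dx$ if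 $a_1<\beta_P(v)$. For $P\in B_2\setminus B_1$, $\alpha_P(v)=\lfloor\delta_P(v-1)/p\rfloor$, $\beta_P(v)=\delta_P(v-1)-p\alpha_P(v)$, $H_P=\{y_2^{a_2}y_1^{a_1}x_P^vdx\in W_P:\beta_P(v)\le a_2\}$, $\kappa(\mathcal{C}(\omega))=y_2^{a_2-\beta_P(v)}y_1^{a_1}x_P^{v-e_P\alpha_P(v)}dx$. (Here $\kappa(\mathcal{C}(\omega))$ is a formal label "key term", a monomial differential.) -}

module Defs where

open import Data.Nat using (ℕ; zero; suc; _+_; _*_; _∸_; _≤_; _<_; _≤?_; NonZero; >-nonZero; z<s)
open import Data.Nat.DivMod using (_/_)
open import Data.Nat.Primality using (Prime)
open import Data.Nat.Divisibility using (_∣_)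
open import Data.Nat.Properties using (<-trans)
open import Data.Integer as ℤ using (ℤ; +_)
open import Data.Bool using (Bool; true; false; if_then_else_)
open import Data.Maybe using (Maybe; just; nothing)
open import Data.Product using (_×_)
open import Data.Sum using (_⊎_)
open import Relation.Nullary using (does)
open import Relation.Binary.PropositionalEquality using (_≡_)

-- Points of P^1_k : nothing = ∞, just P = the finite point P ∈ k.

record Setting : Set₁ where
  field
    K      : Set              -- the field k (only its points and 0 matter)
    0K     : K
    p      : ℕ
    p-prime : Prime p
    p>2    : 2 < p
    B₁ B₂  : Maybe K → Bool
    ∞∈B₁   : B₁ nothing ≡ true
    B₁⊆B₂  : ∀ P → B₁ P ≡ true → B₂ P ≡ true
    d e    : Maybe K → ℕ
    d-nz   : ∀ P → NonZero (d P)
    e-nz   : ∀ P → NonZero (e P)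
    d∣     : ∀ P → B₁ P ≡ true → d P ∣ p ∸ 1
    e∣     : ∀ P → B₁ P ≡ false → B₂ P ≡ true → e P ∣ p ∸ 1

-- A monomial differential  y₂^c₂ y₁^c₁ x_P^ex dx
record MonoDiff (K : Set) : Set where
  constructor mono
  field
    c₂ c₁ : ℕ
    pt    : Maybe K
    ex    : ℤ

module _ (S : Setting) where
  open Setting S

  p-nz : NonZero p
  p-nz = >-nonZero (<-trans z<s p>2)

  -- v - ε_P  (ε_∞ = -1, ε_P = 1 otherwise)
  shift : Maybe K → ℕ → ℕ
  shift nothing  v = suc v
  shift (just _) v = v ∸ 1

  γ δ : Maybe K → ℕ
  γ P = _/_ (p ∸ 1) (d P) {{d-nz P}}
  δ P = _/_ (p ∸ 1) (e P) {{e-nz P}}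

  -- P ∈ B₁
  α₁ β₁ : Maybe K → ℕ → ℕ
  α₁ P v = _/_ (γ P * shift P v) p {{p-nz}}
  β₁ P v = γ P * shift P v ∸ p * α₁ P v

  -- P ∈ B₂ \ B₁
  α₂ β₂ : Maybe K → ℕ → ℕ
  α₂ P v = _/_ (δ P * (v ∸ 1)) p {{p-nz}}
  β₂ P v = δ P * (v ∸ 1) ∸ p * α₂ P v

  keyExp₁ keyExp₂ : Maybe K → ℕ → ℤ
  keyExp₁ P v = + v ℤ.- + (d P * α₁ P v)
  keyExp₂ P v = + v ℤ.- + (e P * α₂ P v)

  -- y₂^a₂ y₁^a₁ x_P^v dx ∈ W_P
  inW₁ : Maybe K → ℕ → ℕ → ℕ → Set
  inW₁ nothing a₂ a₁ v =
    a₁ < p × a₂ < p ×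
    p * p * v + p * p + 1 ≤ p * d nothing * (p ∸ 1 ∸ a₁) + d nothing * (p * p ∸ p + 1) * (p ∸ 1 ∸ a₂)
  inW₁ (just P) a₂ a₁ v =
    a₁ < p × a₂ < p × 0 < v ×
    p * p * v ≤ p * d (just P) * (p ∸ 1 ∸ a₁) + d (just P) * (p * p ∸ p + 1) * (p ∸ 1 ∸ a₂) + (p * p ∸ 1)

  inW₂ : Maybe K → ℕ → ℕ → ℕ → Set
  inW₂ P a₂ a₁ v = a₁ < p × a₂ < p × 0 < v × p * v ≤ e P * (p ∸ 1 ∸ a₂) + p ∸ 1

  -- y₂^a₂ y₁^a₁ x_P^v dx ∈ H_P  (this includes P ∈ B₂)
  inH : Maybe K → ℕ → ℕ → ℕ → Set
  inH P a₂ a₁ v =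
    if B₁ P
    then (inW₁ P a₂ a₁ v × β₁ P v ≤ a₁ + p * a₂)
    else (B₂ P ≡ true × inW₂ P a₂ a₁ v × β₂ P v ≤ a₂)

  -- the key term κ(C(ω)) of ω = y₂^a₂ y₁^a₁ x_P^v dx
  key : Maybe K → ℕ → ℕ → ℕ → MonoDiff K
  key P a₂ a₁ v =
    if B₁ P
    then (if does (β₁ P v ≤? a₁)
          then mono a₂ (a₁ ∸ β₁ P v) P (keyExp₁ P v)
          else mono (a₂ ∸ 1) (a₁ + p ∸ β₁ P v) P (keyExp₁ P v))
    else mono (a₂ ∸ β₂ P v) a₁ P (keyExp₂ P v)

  -- equality of x_P^u and x_Q^u' as rational functions on P^1
  -- (x_∞ = x, x_P = (x-P)^{-1}; note x_0 = x^{-1})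
  XPowEq : Maybe K → ℤ → Maybe K → ℤ → Set
  XPowEq P u Q u' =
    (P ≡ Q × u ≡ u') ⊎ (u ≡ + 0 × u' ≡ + 0) ⊎
    (P ≡ nothing × Q ≡ just 0K × u' ≡ ℤ.- u) ⊎ (P ≡ just 0K × Q ≡ nothing × u' ≡ ℤ.- u)

  -- equality of monomial differentials y₂^c₂ y₁^c₁ x_P^u dx
  -- (c₁, c₂ < p, so the y-monomials form part of a k(x)-basis)
  SameDiff : MonoDiff K → MonoDiff K → Set
  SameDiff (mono c₂ c₁ P u) (mono c₂' c₁' Q u') = c₂ ≡ c₂' × c₁ ≡ c₁' × XPowEq P u Q u'

{-# OPTIONS --safe #-}
module Submission where

-- Write the key term of ω = y₂^a₂ y₁^a₁ x_P^v dx ∈ H_P as y₂^c₂ y₁^c₁ x_P^n dx, and let m = d_P and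
-- N = a₁ + p a₂, c = c₁ + p c₂ if P ∈ B₁ (m = e_P, N = a₂, c = c₂ otherwise). Then c is N − β_P(v)
-- written in base p and n = v − m α_P(v); since m (β_P(v) + p α_P(v)) = (p − 1)(v − ε_P), the
-- weight satisfies v + m N = m c + p n − (p − 1) ε_P. So for a fixed point P and exponent n the
-- weight determines the digits of c and conversely, which gives both equivalences. Moreover n ≥ 0
-- at ∞ and n > 0 at finite points, and such a monomial x_P^n determines P.

open import Data.Bool using (true; false)
open import Data.Empty using (⊥-elim)
open import Data.Integer as ℤ using (+_)
import Data.Integer.Properties as ℤ
open import Data.List using (_∷_; [])
open import Data.Maybe using (Maybe; just; nothing)
open import Data.Nat
open import Data.Nat.Divisibility using (_∣_)
open import Data.Nat.DivMod
  using (_/_; _%_; [m+kn]%n≡m%n; m<n⇒m%n≡m; m/n*n≤m; m%n≡m∸m/n*n; m%n<n; m*[n/m]≡n)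
open import Data.Nat.Properties
open import Algebra.Properties.CommutativeSemigroup +-commutativeSemigroup using (xy∙z≈xz∙y)
open import Data.Nat.Tactic.RingSolver using (solve)
open import Data.Product using (_×_; _,_; ∃; ∃₂)
open import Data.Sum using (_⊎_; inj₁; inj₂)
open import Data.Unit using (⊤; tt)
open import Function.Bundles using (_⇔_; mk⇔; Equivalence)
open import Relation.Binary.PropositionalEquality
open import Relation.Nullary.Reflects using (ofʸ; ofⁿ)
open import Defs

≡true⊎≡false : ∀ b → b ≡ true ⊎ b ≡ false
≡true⊎≡false true  = inj₁ refl
≡true⊎≡false false = inj₂ refl

digits-injective : ∀ {p c₁ c₂ c₁' c₂'} → c₁ < p → c₁' < p →
                   c₁ + p * c₂ ≡ c₁' + p * c₂' → c₁ ≡ c₁' × c₂ ≡ c₂'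
digits-injective {p} {c₁} {c₂} {c₁'} {c₂'} c₁<p c₁'<p eq =
  c₁≡c₁' , *-cancelˡ-≡ c₂ c₂' p (+-cancelˡ-≡ c₁ _ _ (trans eq (cong (_+ p * c₂') (sym c₁≡c₁'))))
  where
  open ≡-Reasoning
  instance
    p≢0 : NonZero p
    p≢0 = >-nonZero (≤-<-trans z≤n c₁<p)
  [c+p*c']%p≡c : ∀ {c c'} → c < p → (c + p * c') % p ≡ c
  [c+p*c']%p≡c {c} {c'} c<p = begin
    (c + p * c') % p  ≡⟨ cong (λ x → (c + x) % p) (*-comm p c') ⟩
    (c + c' * p) % p  ≡⟨ [m+kn]%n≡m%n c c' p ⟩
    c % p             ≡⟨ m<n⇒m%n≡m c<p ⟩
    c                 ∎
  c₁≡c₁' : c₁ ≡ c₁'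
  c₁≡c₁' = trans (sym ([c+p*c']%p≡c c₁<p)) (trans (cong (_% p) eq) ([c+p*c']%p≡c c₁'<p))

sub-digit : ∀ p a₁ a₂ {β} → β ≤ a₁ → a₁ < p →
            a₁ ∸ β < p × (a₁ ∸ β) + p * a₂ + β ≡ a₁ + p * a₂
sub-digit p a₁ a₂ {β} β≤a₁ a₁<p =
  ≤-<-trans (m∸n≤m a₁ β) a₁<p ,
  trans (xy∙z≈xz∙y (a₁ ∸ β) (p * a₂) β) (cong (_+ p * a₂) (m∸n+n≡m β≤a₁))

sub-digit-borrow : ∀ p a₁ a₂ {β} → a₁ < β → β < p → β ≤ a₁ + p * a₂ →
                   a₁ + p ∸ β < p × (a₁ + p ∸ β) + p * (a₂ ∸ 1) + β ≡ a₁ + p * a₂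
sub-digit-borrow p a₁ zero a₁<β _ β≤a₁+p*0 =
  ⊥-elim (<⇒≱ a₁<β (subst (_ ≤_) (trans (cong (λ x → a₁ + x) (*-zeroʳ p)) (+-identityʳ a₁)) β≤a₁+p*0))
sub-digit-borrow p a₁ (suc a₂) {β} a₁<β β<p _ = digit<p , (begin
  (a₁ + p ∸ β) + p * a₂ + β  ≡⟨ xy∙z≈xz∙y (a₁ + p ∸ β) (p * a₂) β ⟩
  (a₁ + p ∸ β) + β + p * a₂  ≡⟨ cong (_+ p * a₂) (m∸n+n≡m β≤a₁+p) ⟩
  a₁ + p + p * a₂            ≡⟨ solve (a₁ ∷ p ∷ a₂ ∷ []) ⟩
  a₁ + p * suc a₂            ∎)
  where
  open ≡-Reasoning
  β≤a₁+p : β ≤ a₁ + p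
  β≤a₁+p = ≤-trans (<⇒≤ β<p) (m≤n+m p a₁)
  digit<p : a₁ + p ∸ β < p
  digit<p = subst (a₁ + p ∸ β <_) (m+n∸m≡n β p) (∸-monoˡ-< (+-monoˡ-< p a₁<β) β≤a₁+p)

m∸n*[m/n]+n*[m/n]≡m : ∀ m n .{{_ : NonZero n}} → m ∸ n * (m / n) + n * (m / n) ≡ m
m∸n*[m/n]+n*[m/n]≡m m n = m∸n+n≡m (subst (_≤ m) (*-comm (m / n) n) (m/n*n≤m m n))

m∸n*[m/n]<n : ∀ m n .{{_ : NonZero n}} → m ∸ n * (m / n) < n
m∸n*[m/n]<n m n = subst (_< n) (trans (m%n≡m∸m/n*n m n) (cong (m ∸_) (*-comm (m / n) n))) (m%n<n m n)

m∣n⇒m*[n/m*k]≡n*k : ∀ {m n} .{{_ : NonZero m}} → m ∣ n → ∀ k → m * (n / m * k) ≡ n * k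
m∣n⇒m*[n/m*k]≡n*k {m} {n} m∣n k = trans (sym (*-assoc m (n / m) k)) (cong (_* k) (m*[n/m]≡n m∣n))

+m-+n≡+[m∸n] : ∀ {m n} → n ≤ m → + m ℤ.- + n ≡ + (m ∸ n)
+m-+n≡+[m∸n] {m} {n} n≤m = trans (ℤ.m-n≡m⊖n m n) (ℤ.⊖-≥ n≤m)

+[1+m]≢-+n : ∀ m n → + suc m ≢ ℤ.- + n
+[1+m]≢-+n m zero    ()
+[1+m]≢-+n m (suc n) ()

p*[m*α]≤m*[β+p*α] : ∀ p m β α → p * (m * α) ≤ m * (β + p * α)
p*[m*α]≤m*[β+p*α] p m β α = begin
  p * (m * α)      ≡⟨ solve (p ∷ m ∷ α ∷ []) ⟩
  m * (p * α)      ≤⟨ *-monoʳ-≤ m (m≤n+m (p * α) β) ⟩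
  m * (β + p * α)  ∎
  where open ≤-Reasoning

p*x≤q*y⇒x≤y : ∀ {p q x y} → p ≡ suc q → p * x ≤ q * y → x ≤ y
p*x≤q*y⇒x≤y {q = q} {y = y} refl h = *-cancelˡ-≤ (suc q) (≤-trans h (*-monoˡ-≤ y (n≤1+n q)))

p*x≤q*[1+y]⇒x≤y : ∀ {p q x y} → p ≡ suc q → p * x ≤ q * suc y → x ≤ y
p*x≤q*[1+y]⇒x≤y {q = q} {x} {y} refl h =
  s≤s⁻¹ (*-cancelˡ-< (suc q) x (suc y) (≤-<-trans h (*-monoˡ-< (suc y) (n<1+n q))))

quotient-bound : ∀ {p q} m β α {y} → p ≡ suc q → m * (β + p * α) ≡ q * y → m * α ≤ y
quotient-bound {p} m β α p≡1+q h =
  p*x≤q*y⇒x≤y p≡1+q (≤-trans (p*[m*α]≤m*[β+p*α] p m β α) (≤-reflexive h))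

quotient-bound-suc : ∀ {p q} m β α {y} → p ≡ suc q → m * (β + p * α) ≡ q * suc y → m * α ≤ y
quotient-bound-suc {p} m β α p≡1+q h =
  p*x≤q*[1+y]⇒x≤y p≡1+q (≤-trans (p*[m*α]≤m*[β+p*α] p m β α) (≤-reflexive h))

weight-∞ : ∀ {p q} m β α {v} c → p ≡ suc q → m * (β + p * α) ≡ q * suc v →
           v + m * (c + β) ≡ m * c + p * (v ∸ m * α) + q
weight-∞ {q = q} m β α {v} c refl h with v ∸ m * α | m∸n+n≡m (quotient-bound-suc {q = q} m β α refl h)
... | n | refl = +-cancelʳ-≡ (suc q * (m * α)) _ _ (begin
  n + m * α + m * (c + β) + suc q * (m * α)   ≡⟨ solve (n ∷ m ∷ α ∷ c ∷ β ∷ q ∷ []) ⟩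
  m * c + (n + m * α) + m * (β + suc q * α)  ≡⟨ cong (λ x → m * c + (n + m * α) + x) h ⟩
  m * c + (n + m * α) + q * suc (n + m * α)  ≡⟨ solve (n ∷ m ∷ α ∷ c ∷ q ∷ []) ⟩
  m * c + suc q * n + q + suc q * (m * α)    ∎)
  where open ≡-Reasoning

weight-fin : ∀ {p q} m β α {s} c → p ≡ suc q → m * (β + p * α) ≡ q * s →
             suc s + m * (c + β) + q ≡ m * c + p * (suc s ∸ m * α)
weight-fin {q = q} m β α {s} c refl h with s ∸ m * α | m∸n+n≡m (quotient-bound {q = q} m β α refl h)
... | k | refl = +-cancelʳ-≡ (suc q * (m * α)) _ _ (begin
  suc (k + m * α) + m * (c + β) + q + suc q * (m * α)  ≡⟨ solve (k ∷ m ∷ α ∷ c ∷ β ∷ q ∷ []) ⟩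
  m * c + suc (k + m * α) + q + m * (β + suc q * α)   ≡⟨ cong (λ x → m * c + suc (k + m * α) + q + x) h ⟩
  m * c + suc (k + m * α) + q + q * (k + m * α)       ≡⟨ solve (k ∷ m ∷ α ∷ c ∷ q ∷ []) ⟩
  m * c + suc q * suc k + suc q * (m * α)             ≡⟨ cong (λ x → m * c + suc q * x + suc q * (m * α))
                                                              (sym (m+n∸n≡m (suc k) (m * α))) ⟩
  m * c + suc q * (suc k + m * α ∸ m * α) + suc q * (m * α) ∎)
  where open ≡-Reasoning

module _ (S : Setting) where
  open Setting S

  private instance
    p≢0 : NonZero p
    p≢0 = p-nz S

  q : ℕ
  q = p ∸ 1

  p≡1+q : p ≡ suc q
  p≡1+q with p | p>2
  ... | suc _ | _ = refl

  d*[β₁+p*α₁]≡q*shift : ∀ {P} v → B₁ P ≡ true → d P * (β₁ S P v + p * α₁ S P v) ≡ q * shift S P v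
  d*[β₁+p*α₁]≡q*shift {P} v P∈B₁ =
    trans (cong (d P *_) (m∸n*[m/n]+n*[m/n]≡m _ p)) (m∣n⇒m*[n/m*k]≡n*k {{d-nz P}} (d∣ P P∈B₁) (shift S P v))

  e*[β₂+p*α₂]≡q*[v-1] : ∀ {P} v → B₁ P ≡ false → B₂ P ≡ true → e P * (β₂ S P v + p * α₂ S P v) ≡ q * (v ∸ 1)
  e*[β₂+p*α₂]≡q*[v-1] {P} v P∉B₁ P∈B₂ =
    trans (cong (e P *_) (m∸n*[m/n]+n*[m/n]≡m _ p)) (m∣n⇒m*[n/m*k]≡n*k {{e-nz P}} (e∣ P P∉B₁ P∈B₂) (v ∸ 1))

  PoleExp : Maybe K → ℕ → Set
  PoleExp nothing  _ = ⊤
  PoleExp (just _) n = 0 < n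

  -- v + m N = m c + p n − (p − 1) ε_P, with (p − 1) ε_P moved to the side where it is nonnegative.
  WeightEq : Maybe K → ℕ → ℕ → ℕ → Set
  WeightEq nothing  x y n = x ≡ y + p * n + q
  WeightEq (just _) x y n = x + q ≡ y + p * n

  WeightEq-cancel : ∀ P {x y n x' y' n'} → WeightEq P x y n → WeightEq P x' y' n' → n ≡ n' → x ≡ x' ⇔ y ≡ y'
  WeightEq-cancel nothing {n = n} eq eq' refl = mk⇔
    (λ x≡x' → +-cancelʳ-≡ (p * n) _ _ (+-cancelʳ-≡ q _ _ (trans (sym eq) (trans x≡x' eq'))))
    (λ y≡y' → trans eq (trans (cong (λ y → y + p * n + q) y≡y') (sym eq')))
  WeightEq-cancel (just _) {n = n} eq eq' refl = mk⇔
    (λ x≡x' → +-cancelʳ-≡ (p * n) _ _ (trans (sym eq) (trans (cong (_+ q) x≡x') eq')))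
    (λ y≡y' → +-cancelʳ-≡ q _ _ (trans eq (trans (cong (_+ p * n) y≡y') (sym eq'))))

  keyExponent : ∀ P m β α {v} → m * (β + p * α) ≡ q * shift S P v → PoleExp P v →
                m * α ≤ v × PoleExp P (v ∸ m * α)
  keyExponent nothing  m β α h _ = quotient-bound-suc m β α p≡1+q h , tt
  keyExponent (just _) m β α {suc s} h _ = m≤n⇒m≤1+n m*α≤s , m<n⇒0<n∸m (s≤s m*α≤s)
    where m*α≤s = quotient-bound m β α p≡1+q h

  weightEq : ∀ P m β α {v} c → m * (β + p * α) ≡ q * shift S P v → PoleExp P v →
             WeightEq P (v + m * (c + β)) (m * c) (v ∸ m * α)
  weightEq nothing  m β α         c h _ = weight-∞ m β α c p≡1+q h
  weightEq (just _) m β α {suc s} c h _ = weight-fin m β α c p≡1+q h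

  inH-B₁ : ∀ {P a₂ a₁ v} → B₁ P ≡ true → inH S P a₂ a₁ v → inW₁ S P a₂ a₁ v × β₁ S P v ≤ a₁ + p * a₂
  inH-B₁ P∈B₁ ω∈H rewrite P∈B₁ = ω∈H

  inH-B₂ : ∀ {P a₂ a₁ v} → B₁ P ≡ false → inH S P a₂ a₁ v → B₂ P ≡ true × inW₂ S P a₂ a₁ v × β₂ S P v ≤ a₂
  inH-B₂ P∉B₁ ω∈H rewrite P∉B₁ = ω∈H

  inW₁⇒a₁<p×PoleExp : ∀ P {a₂ a₁ v} → inW₁ S P a₂ a₁ v → a₁ < p × PoleExp P v
  inW₁⇒a₁<p×PoleExp nothing  (a₁<p , _)           = a₁<p , tt
  inW₁⇒a₁<p×PoleExp (just _) (a₁<p , _ , 0<v , _) = a₁<p , 0<v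

  key-B₁ : ∀ {P a₂ a₁ v} → B₁ P ≡ true → a₁ < p → β₁ S P v ≤ a₁ + p * a₂ →
           ∃₂ λ c₂ c₁ → key S P a₂ a₁ v ≡ mono c₂ c₁ P (keyExp₁ S P v)
                        × c₁ < p × c₁ + p * c₂ + β₁ S P v ≡ a₁ + p * a₂
  -- key tests does (β₁ ≤? a₁), which computes to β₁ ≤ᵇ a₁; that is the term to split on.
  key-B₁ {P} {a₂} {a₁} {v} P∈B₁ a₁<p β≤N
    rewrite P∈B₁ with β₁ S P v ≤ᵇ a₁ | ≤ᵇ-reflects-≤ (β₁ S P v) a₁
  ... | true  | ofʸ β≤a₁ = a₂ , a₁ ∸ β₁ S P v , refl , sub-digit p a₁ a₂ β≤a₁ a₁<p
  ... | false | ofⁿ β≰a₁ = a₂ ∸ 1 , a₁ + p ∸ β₁ S P v , refl ,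
                           sub-digit-borrow p a₁ a₂ (≰⇒> β≰a₁) (m∸n*[m/n]<n _ p) β≤N

  key-B₂ : ∀ {P a₂ a₁ v} → B₁ P ≡ false → key S P a₂ a₁ v ≡ mono (a₂ ∸ β₂ S P v) a₁ P (keyExp₂ S P v)
  key-B₂ P∉B₁ rewrite P∉B₁ = refl

  record KeyTerm₁ (P : Maybe K) (a₂ a₁ v : ℕ) : Set where
    field
      c₂ c₁ n : ℕ
      key≡    : key S P a₂ a₁ v ≡ mono c₂ c₁ P (+ n)
      keyExp≡ : keyExp₁ S P v ≡ + n
      c₁<p    : c₁ < p
      pole    : PoleExp P n
      weight  : WeightEq P (v + d P * (a₁ + p * a₂)) (d P * (c₁ + p * c₂)) n

  record KeyTerm₂ (P : Maybe K) (a₂ a₁ v : ℕ) : Set where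
    field
      c₂ n    : ℕ
      key≡    : key S P a₂ a₁ v ≡ mono c₂ a₁ P (+ n)
      keyExp≡ : keyExp₂ S P v ≡ + n
      pole    : PoleExp P n
      weight  : WeightEq P (v + e P * a₂) (e P * c₂) n

  keyTerm₁ : ∀ {P a₂ a₁ v} → B₁ P ≡ true → inH S P a₂ a₁ v → KeyTerm₁ P a₂ a₁ v
  keyTerm₁ {P} {a₂} {a₁} {v} P∈B₁ ω∈H
    with (ω∈W , β≤N) ← inH-B₁ P∈B₁ ω∈H
    with (a₁<p , v∈W) ← inW₁⇒a₁<p×PoleExp P ω∈W
    with (c₂ , c₁ , key≡ , c₁<p , c+β≡N) ← key-B₁ P∈B₁ a₁<p β≤N
    with h ← d*[β₁+p*α₁]≡q*shift v P∈B₁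
    with (d*α≤v , n∈W) ← keyExponent P (d P) (β₁ S P v) (α₁ S P v) h v∈W
    = record
      { c₂ = c₂ ; c₁ = c₁ ; n = v ∸ d P * α₁ S P v
      ; key≡    = trans key≡ (cong (mono c₂ c₁ P) (+m-+n≡+[m∸n] d*α≤v))
      ; keyExp≡ = +m-+n≡+[m∸n] d*α≤v
      ; c₁<p    = c₁<p
      ; pole    = n∈W
      ; weight  = subst (λ N → WeightEq P (v + d P * N) (d P * (c₁ + p * c₂)) (v ∸ d P * α₁ S P v)) c+β≡N
                        (weightEq P (d P) (β₁ S P v) (α₁ S P v) (c₁ + p * c₂) h v∈W)
      }

  keyTerm₂ : ∀ {P a₂ a₁ v} → B₁ P ≡ false → inH S P a₂ a₁ v → KeyTerm₂ P a₂ a₁ v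
  keyTerm₂ {nothing} ∞∉B₁ _ with () ← trans (sym ∞∈B₁) ∞∉B₁
  keyTerm₂ {P@(just _)} {a₂} {a₁} {v} P∉B₁ ω∈H
    with (P∈B₂ , (_ , _ , 0<v , _) , β≤a₂) ← inH-B₂ P∉B₁ ω∈H
    with h ← e*[β₂+p*α₂]≡q*[v-1] v P∉B₁ P∈B₂
    with (e*α≤v , n∈W) ← keyExponent P (e P) (β₂ S P v) (α₂ S P v) h 0<v
    = record
      { c₂ = a₂ ∸ β₂ S P v ; n = v ∸ e P * α₂ S P v
      ; key≡    = trans (key-B₂ P∉B₁) (cong (mono (a₂ ∸ β₂ S P v) a₁ P) (+m-+n≡+[m∸n] e*α≤v))
      ; keyExp≡ = +m-+n≡+[m∸n] e*α≤v
      ; pole    = n∈W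
      ; weight  = subst (λ N → WeightEq P (v + e P * N) (e P * (a₂ ∸ β₂ S P v)) (v ∸ e P * α₂ S P v))
                        (m∸n+n≡m β≤a₂) (weightEq P (e P) (β₂ S P v) (α₂ S P v) (a₂ ∸ β₂ S P v) h 0<v)
      }

  -- x_P^n with n > 0 has its only pole at the finite point P, whereas x^n has none there.
  samePoint : ∀ {P Q n n'} → PoleExp P n → PoleExp Q n' → XPowEq S P (+ n) Q (+ n') → P ≡ Q
  samePoint _ _ (inj₁ (P≡Q , _)) = P≡Q
  samePoint {nothing}  {nothing} _ _ (inj₂ _) = refl
  samePoint {nothing}  {just _}  _ () (inj₂ (inj₁ (_ , refl)))
  samePoint {just _}   {_}       () _ (inj₂ (inj₁ (refl , _)))
  samePoint {nothing}  {just _} {n} _ (s≤s _) (inj₂ (inj₂ (inj₁ (_ , _ , n'≡-n)))) = ⊥-elim (+[1+m]≢-+n _ n n'≡-n)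
  samePoint {just _}   {nothing} (s≤s _) _ (inj₂ (inj₂ (inj₂ (_ , _ , ()))))
  samePoint {just _}   {_}       _ _ (inj₂ (inj₂ (inj₁ (() , _))))
  samePoint {nothing}  {_}       _ _ (inj₂ (inj₂ (inj₂ (() , _))))
  samePoint {just _}   {just _}  _ _ (inj₂ (inj₂ (inj₂ (_ , () , _))))

  XPowEq-at-point : ∀ {P u u'} → XPowEq S P u P u' → u ≡ u'
  XPowEq-at-point         (inj₁ (_ , u≡u'))              = u≡u'
  XPowEq-at-point         (inj₂ (inj₁ (u≡0 , u'≡0)))     = trans u≡0 (sym u'≡0)
  XPowEq-at-point {nothing} (inj₂ (inj₂ (inj₁ (_ , () , _))))
  XPowEq-at-point {just _}  (inj₂ (inj₂ (inj₁ (() , _))))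
  XPowEq-at-point {nothing} (inj₂ (inj₂ (inj₂ (() , _))))
  XPowEq-at-point {just _}  (inj₂ (inj₂ (inj₂ (_ , () , _))))

  SameDiff-at-point : ∀ {P c₂ c₁ n c₂' c₁' n'} → SameDiff S (mono c₂ c₁ P (+ n)) (mono c₂' c₁' P (+ n')) →
                      c₂ ≡ c₂' × c₁ ≡ c₁' × n ≡ n'
  SameDiff-at-point (c₂≡c₂' , c₁≡c₁' , xp) = c₂≡c₂' , c₁≡c₁' , ℤ.+-injective (XPowEq-at-point xp)

  keyShape : ∀ {P a₂ a₁ v} → inH S P a₂ a₁ v →
             ∃₂ λ c₂ c₁ → ∃ λ n → key S P a₂ a₁ v ≡ mono c₂ c₁ P (+ n) × PoleExp P n
  keyShape {P} {_} {a₁} ω∈H with ≡true⊎≡false (B₁ P)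
  ... | inj₁ P∈B₁ = let open KeyTerm₁ (keyTerm₁ P∈B₁ ω∈H) in c₂ , c₁ , n , key≡ , pole
  ... | inj₂ P∉B₁ = let open KeyTerm₂ (keyTerm₂ P∉B₁ ω∈H) in c₂ , a₁ , n , key≡ , pole

  sameKey⇒samePoint : ∀ {P Q a₂ a₁ v b₂ b₁ w} → inH S P a₂ a₁ v → inH S Q b₂ b₁ w →
                      SameDiff S (key S P a₂ a₁ v) (key S Q b₂ b₁ w) → P ≡ Q
  sameKey⇒samePoint ω∈H ω'∈H same
    with (_ , _ , _ , key≡ , pole) ← keyShape ω∈H
    with (_ , _ , _ , key≡' , pole') ← keyShape ω'∈H
    with (_ , _ , xp) ← subst₂ (SameDiff S) key≡ key≡' same
    = samePoint pole pole' xp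

  sameKey₁⇔ : ∀ {P a₂ a₁ v b₂ b₁ w} → B₁ P ≡ true → inH S P a₂ a₁ v → inH S P b₂ b₁ w →
              SameDiff S (key S P a₂ a₁ v) (key S P b₂ b₁ w)
                ⇔ (v + d P * (a₁ + p * a₂) ≡ w + d P * (b₁ + p * b₂) × keyExp₁ S P v ≡ keyExp₁ S P w)
  sameKey₁⇔ {P} {a₂} {a₁} {v} {b₂} {b₁} {w} P∈B₁ ω∈H ω'∈H = mk⇔ same⇒ ⇒same
    where
    open KeyTerm₁ (keyTerm₁ P∈B₁ ω∈H)
    open KeyTerm₁ (keyTerm₁ P∈B₁ ω'∈H) renaming
      (c₂ to c₂'; c₁ to c₁'; n to n'; key≡ to key≡'; keyExp≡ to keyExp≡'; c₁<p to c₁'<p; weight to weight')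
    cancel : n ≡ n' → v + d P * (a₁ + p * a₂) ≡ w + d P * (b₁ + p * b₂) ⇔ d P * (c₁ + p * c₂) ≡ d P * (c₁' + p * c₂')
    cancel = WeightEq-cancel P weight weight'
    same⇒ : SameDiff S (key S P a₂ a₁ v) (key S P b₂ b₁ w) →
            v + d P * (a₁ + p * a₂) ≡ w + d P * (b₁ + p * b₂) × keyExp₁ S P v ≡ keyExp₁ S P w
    same⇒ same with (c₂≡c₂' , c₁≡c₁' , n≡n') ← SameDiff-at-point (subst₂ (SameDiff S) key≡ key≡' same) =
      Equivalence.from (cancel n≡n') (cong₂ (λ c₁ c₂ → d P * (c₁ + p * c₂)) c₁≡c₁' c₂≡c₂') ,
      trans keyExp≡ (trans (cong +_ n≡n') (sym keyExp≡'))
    ⇒same : v + d P * (a₁ + p * a₂) ≡ w + d P * (b₁ + p * b₂) × keyExp₁ S P v ≡ keyExp₁ S P w →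
            SameDiff S (key S P a₂ a₁ v) (key S P b₂ b₁ w)
    ⇒same (x≡x' , u≡u') with n≡n' ← ℤ.+-injective (trans (sym keyExp≡) (trans u≡u' keyExp≡'))
      with (c₁≡c₁' , c₂≡c₂') ← digits-injective c₁<p c₁'<p
             (*-cancelˡ-≡ _ _ (d P) {{d-nz P}} (Equivalence.to (cancel n≡n') x≡x'))
      = subst₂ (SameDiff S) (sym key≡) (sym key≡') (c₂≡c₂' , c₁≡c₁' , inj₁ (refl , cong +_ n≡n'))

  sameKey₂⇔ : ∀ {P a₂ a₁ v b₂ b₁ w} → B₁ P ≡ false → inH S P a₂ a₁ v → inH S P b₂ b₁ w →
              SameDiff S (key S P a₂ a₁ v) (key S P b₂ b₁ w)
                ⇔ (v + e P * a₂ ≡ w + e P * b₂ × a₁ ≡ b₁ × keyExp₂ S P v ≡ keyExp₂ S P w)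
  sameKey₂⇔ {P} {a₂} {a₁} {v} {b₂} {b₁} {w} P∉B₁ ω∈H ω'∈H = mk⇔ same⇒ ⇒same
    where
    open KeyTerm₂ (keyTerm₂ P∉B₁ ω∈H)
    open KeyTerm₂ (keyTerm₂ P∉B₁ ω'∈H) renaming
      (c₂ to c₂'; n to n'; key≡ to key≡'; keyExp≡ to keyExp≡'; weight to weight')
    cancel : n ≡ n' → v + e P * a₂ ≡ w + e P * b₂ ⇔ e P * c₂ ≡ e P * c₂'
    cancel = WeightEq-cancel P weight weight'
    same⇒ : SameDiff S (key S P a₂ a₁ v) (key S P b₂ b₁ w) →
            v + e P * a₂ ≡ w + e P * b₂ × a₁ ≡ b₁ × keyExp₂ S P v ≡ keyExp₂ S P w
    same⇒ same with (c₂≡c₂' , a₁≡b₁ , n≡n') ← SameDiff-at-point (subst₂ (SameDiff S) key≡ key≡' same) =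
      Equivalence.from (cancel n≡n') (cong (e P *_) c₂≡c₂') , a₁≡b₁ ,
      trans keyExp≡ (trans (cong +_ n≡n') (sym keyExp≡'))
    ⇒same : v + e P * a₂ ≡ w + e P * b₂ × a₁ ≡ b₁ × keyExp₂ S P v ≡ keyExp₂ S P w →
            SameDiff S (key S P a₂ a₁ v) (key S P b₂ b₁ w)
    ⇒same (x≡x' , a₁≡b₁ , u≡u') with n≡n' ← ℤ.+-injective (trans (sym keyExp≡) (trans u≡u' keyExp≡'))
      = subst₂ (SameDiff S) (sym key≡) (sym key≡')
          (*-cancelˡ-≡ _ _ (e P) {{e-nz P}} (Equivalence.to (cancel n≡n') x≡x') , a₁≡b₁ , inj₁ (refl , cong +_ n≡n'))

lemma3p7 : (S : Setting) → let open Setting S in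
    (P Q : Maybe K) (a₂ a₁ v b₂ b₁ w : ℕ) →
    inH S P a₂ a₁ v → inH S Q b₂ b₁ w →
    (SameDiff S (key S P a₂ a₁ v) (key S Q b₂ b₁ w) → P ≡ Q)
    × (P ≡ Q → B₁ P ≡ true →
        (SameDiff S (key S P a₂ a₁ v) (key S Q b₂ b₁ w)
          ⇔ (v + d P * (a₁ + p * a₂) ≡ w + d P * (b₁ + p * b₂)
             × keyExp₁ S P v ≡ keyExp₁ S P w)))
    × (P ≡ Q → B₁ P ≡ false → B₂ P ≡ true →
        (SameDiff S (key S P a₂ a₁ v) (key S Q b₂ b₁ w)
          ⇔ (v + e P * a₂ ≡ w + e P * b₂ × a₁ ≡ b₁
             × keyExp₂ S P v ≡ keyExp₂ S P w)))
lemma3p7 S P Q a₂ a₁ v b₂ b₁ w ω∈H ω'∈H =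
  sameKey⇒samePoint S ω∈H ω'∈H ,
  (λ { refl P∈B₁ → sameKey₁⇔ S P∈B₁ ω∈H ω'∈H }) ,
  -- B₂ P ≡ true is already part of ω ∈ H_P.
  (λ { refl P∉B₁ _ → sameKey₂⇔ S P∉B₁ ω∈H ω'∈H })
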